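{- For every integer $d\geq 3$, we have $\kappa_{d+1}\geq \kappa_d$.
   Context: For an integer $d\geq 2$, consider a finite simple $(d-1)$-uniform hypergraph $H$ (no hyperedge appears twice) in which each hyperedge receives exactly one of $d$ colors $c_1,\ldots,c_d$. Let $C_i$ be the number of hyperedges of color $c_i$, and let $T$ be the number of rainbow $K^{(d-1)}_d$'s in $H$, i.e. the number of $d$-subsets of $V(H)$ all of whose $d$ subsets of size $d-1$ are hyperedges of $H$ and these $d$ hyperedges have $d$ distinct colors. Define $\kappa_d$ to be the supremum of the ratio $T^{d-1}/(C_1C_2\cdots C_d)$ over all such colored hypergraphs (with all $C_i>0$). -}

module Defs where

open import Data.Nat using (ℕ; zero; suc; _∸_; _≟_)
open import Data.Bool using (Bool)
open import Data.Fin using (Fin)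
import Data.Fin as F
open import Data.Fin.Subset using (Subset; inside; outside; ∣_∣)
open import Data.Maybe using (Maybe; just; nothing; Is-just)
import Data.Maybe.Properties as MP
open import Data.Maybe.Relation.Unary.Any using () renaming (dec to isJust?)
open import Data.List using (List; []; _∷_; map; _++_; length; filter; allFin)
open import Data.Nat.ListAction using (product)
open import Data.List.Relation.Unary.All using (All; all?)
open import Data.Vec using (Vec; lookup; _[_]≔_) renaming ([] to []ᵥ; _∷_ to _∷ᵥ_)
open import Data.Product using (_×_)
open import Relation.Nullary.Decidable using (Dec; _×-dec_)
open import Relation.Binary.PropositionalEquality using (_≡_)
open import Data.List.Relation.Unary.Unique.Propositional using (Unique)
import Data.List.Relation.Unary.Unique.DecPropositional as UDP

allSubsets : (n : ℕ) → List (Subset n)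
allSubsets zero    = []ᵥ ∷ []
allSubsets (suc n) = map (inside ∷ᵥ_) (allSubsets n) ++ map (outside ∷ᵥ_) (allSubsets n)

-- A colouring of a hypergraph on vertex set Fin n with colours Fin d:
-- a vertex subset s is a hyperedge iff χ s ≡ just c, and then c is its colour.
-- (This encodes simplicity: no hyperedge appears twice.)
Colouring : ℕ → ℕ → Set
Colouring n d = Subset n → Maybe (Fin d)

Uniform : ∀ {n d} → ℕ → Colouring n d → Set
Uniform k χ = ∀ s c → χ s ≡ just c → ∣ s ∣ ≡ k

count : ∀ {A : Set} {P : A → Set} → (∀ x → Dec (P x)) → List A → ℕ
count P? xs = length (filter P? xs)

colourCount : ∀ {n d} → Colouring n d → Fin d → ℕ
colourCount {n} χ i = count (λ s → MP.≡-dec F._≟_ (χ s) (just i)) (allSubsets n)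

colourProduct : ∀ {n d} → Colouring n d → ℕ
colourProduct {d = d} χ = product (map (colourCount χ) (allFin d))

faces : ∀ {n} → Subset n → List (Subset n)
faces {n} s = Data.List.map (λ x → s [ x ]≔ outside)
                (filter (λ x → Data.Bool._≟_ (lookup s x) inside) (allFin n))

faceColours : ∀ {n d} → Colouring n d → Subset n → List (Maybe (Fin d))
faceColours χ s = map χ (faces s)

-- s spans a rainbow K_d^{(d-1)}: |s| = d, every (d-1)-subset of s is a hyperedge,
-- and these d hyperedges have pairwise distinct colours.
Rainbow : ∀ {n d} → Colouring n d → Subset n → Set
Rainbow {d = d} χ s = (∣ s ∣ ≡ d) × All Is-just (faceColours χ s) × Unique (faceColours χ s)

rainbow? : ∀ {n d} (χ : Colouring n d) s → Dec (Rainbow χ s)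
rainbow? {d = d} χ s =
  (∣ s ∣ ≟ d) ×-dec (all? (λ m → isJust? (λ _ → Relation.Nullary.Decidable.yes _) m) (faceColours χ s)
              ×-dec UDP.unique? (MP.≡-dec F._≟_) (faceColours χ s))
  where import Relation.Nullary.Decidable

rainbowCount : ∀ {n d} → Colouring n d → ℕ
rainbowCount {n} χ = count (rainbow? χ) (allSubsets n)

{-# OPTIONS --safe #-}
-- Cone over a new apex vertex 0: each hyperedge e of colour c_i becomes e ∪ {0} of colour
-- c_{i+1}, and each rainbow d-set of the old hypergraph becomes a hyperedge of the new colour
-- c_0. Then C′_0 = T, C′_{i+1} = C_i and every old rainbow set s gives the rainbow set s ∪ {0},
-- so T′ ≥ T and T′^d / (C′_0 ⋯ C′_d) ≥ T^d / (T C_1 ⋯ C_d) = T^{d-1} / (C_1 ⋯ C_d).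
module Submission where

open import Defs
open import Data.Nat using (ℕ; suc; _*_; _^_; _∸_; _<_; _≤_)
open import Data.Fin using (Fin)
open import Data.Product using (Σ; _×_)

open import Data.Nat using (_+_; s≤s; >-nonZero)
open import Data.Nat.Properties
  using (+-identityʳ; m≤m+n; *-zeroʳ; *-monoʳ-<; *-monoʳ-≤; ^-monoˡ-≤; n≢0⇒n>0; m<n⇒n≢0;
         *-commutativeSemigroup; module ≤-Reasoning)
open import Algebra.Properties.CommutativeSemigroup *-commutativeSemigroup using (x∙yz≈y∙xz)
open import Data.Nat.ListAction using (product)
import Data.Fin as F
import Data.Fin.Properties as Finₚ
import Data.Bool as B
open import Data.Fin.Subset using (Subset; inside; outside)
open import Data.Maybe using (Maybe; just; nothing; Is-just)
import Data.Maybe as M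
open import Data.Maybe.Properties using (map-injective; ≡-dec)
open import Data.Maybe.Relation.Unary.Any using (just)
open import Data.List using (List; []; _∷_; map; _++_; length; filter; allFin; tabulate)
open import Data.List.Properties
  using (length-++; filter-++; filter-≐; filter-none; map-tabulate; tabulate-cong; map-∘)
open import Data.List.Relation.Unary.All as All using (_∷_; universal)
import Data.List.Relation.Unary.All.Properties as Allₚ
open import Data.List.Relation.Unary.AllPairs using (_∷_)
open import Data.List.Relation.Unary.Unique.Propositional.Properties using ()
  renaming (map⁺ to Unique-map⁺)
open import Data.List.Relation.Binary.Sublist.Propositional using (⊆-refl)
open import Data.List.Relation.Binary.Sublist.Propositional.Properties using (filter⁺)
open import Data.List.Relation.Binary.Sublist.Heterogeneous.Properties using (length-mono-≤)
open import Data.Vec using (lookup; _[_]≔_) renaming (_∷_ to _∷ᵥ_)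
open import Data.Product using (_,_; proj₁; proj₂)
open import Relation.Nullary using (Dec; yes; no; ¬_; contradiction)
open import Relation.Binary.PropositionalEquality
open import Function using (_∘_)

module _ {A : Set} {P Q : A → Set} (P? : ∀ x → Dec (P x)) (Q? : ∀ x → Dec (Q x)) where

  count-≐ : (∀ {x} → P x → Q x) → (∀ {x} → Q x → P x) → ∀ xs → count P? xs ≡ count Q? xs
  count-≐ P⇒Q Q⇒P xs = cong length (filter-≐ P? Q? (P⇒Q , Q⇒P) xs)

  count-mono : (∀ {x} → P x → Q x) → ∀ xs → count P? xs ≤ count Q? xs
  count-mono P⇒Q xs = length-mono-≤ (filter⁺ P? Q? (λ { refl → P⇒Q }) (⊆-refl {x = xs}))

module _ {A : Set} {P : A → Set} (P? : ∀ x → Dec (P x)) where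

  count-++ : ∀ xs ys → count P? (xs ++ ys) ≡ count P? xs + count P? ys
  count-++ xs ys = trans (cong length (filter-++ P? xs ys)) (length-++ (filter P? xs))

  count-none : (∀ x → ¬ P x) → ∀ xs → count P? xs ≡ 0
  count-none ¬P xs = cong length (filter-none P? (universal ¬P xs))

count-map : ∀ {A B : Set} {P : B → Set} (P? : ∀ x → Dec (P x)) (f : A → B) xs →
            count P? (map f xs) ≡ count (P? ∘ f) xs
count-map P? f []       = refl
count-map P? f (x ∷ xs) with P? (f x)
... | yes _ = cong suc (count-map P? f xs)
... | no  _ = count-map P? f xs

count-allSubsets-suc : ∀ {n} {P : Subset (suc n) → Set} (P? : ∀ s → Dec (P s)) →
  count P? (allSubsets (suc n)) ≡
    count (P? ∘ (inside ∷ᵥ_)) (allSubsets n) + count (P? ∘ (outside ∷ᵥ_)) (allSubsets n)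
count-allSubsets-suc {n} P? = begin
  count P? (map (inside ∷ᵥ_) A ++ map (outside ∷ᵥ_) A)
    ≡⟨ count-++ P? (map (inside ∷ᵥ_) A) (map (outside ∷ᵥ_) A) ⟩
  count P? (map (inside ∷ᵥ_) A) + count P? (map (outside ∷ᵥ_) A)
    ≡⟨ cong₂ _+_ (count-map P? (inside ∷ᵥ_) A) (count-map P? (outside ∷ᵥ_) A) ⟩
  count (P? ∘ (inside ∷ᵥ_)) A + count (P? ∘ (outside ∷ᵥ_)) A ∎
  where
  open ≡-Reasoning
  A = allSubsets n

dropEach : ∀ {n} → Subset n → List (Fin n) → List (Subset n)
dropEach s xs = map (λ x → s [ x ]≔ outside) (filter (λ x → lookup s x B.≟ inside) xs)

dropEach-suc : ∀ {n} (s : Subset n) xs →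
  dropEach (inside ∷ᵥ s) (map F.suc xs) ≡ map (inside ∷ᵥ_) (dropEach s xs)
dropEach-suc s []       = refl
dropEach-suc s (x ∷ xs) with lookup s x B.≟ inside
... | yes _ = cong (_ ∷_) (dropEach-suc s xs)
... | no  _ = dropEach-suc s xs

faces-inside : ∀ {n} (s : Subset n) →
  faces (inside ∷ᵥ s) ≡ (outside ∷ᵥ s) ∷ map (inside ∷ᵥ_) (faces s)
faces-inside {n} s = cong ((outside ∷ᵥ s) ∷_) (begin
  dropEach (inside ∷ᵥ s) (tabulate F.suc)         ≡⟨ cong (dropEach _) (map-tabulate (λ x → x) F.suc) ⟨
  dropEach (inside ∷ᵥ s) (map F.suc (allFin n))   ≡⟨ dropEach-suc s (allFin n) ⟩
  map (inside ∷ᵥ_) (faces s)                      ∎)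
  where open ≡-Reasoning

map-suc≢just-zero : ∀ {d} (m : Maybe (Fin d)) → M.map F.suc m ≢ just F.zero
map-suc≢just-zero (just _) ()
map-suc≢just-zero nothing  ()

cone : ∀ {n d} → Colouring n d → Colouring (suc n) (suc d)
cone χ (inside  ∷ᵥ s) = M.map F.suc (χ s)
cone χ (outside ∷ᵥ s) with rainbow? χ s
... | yes _ = just F.zero
... | no  _ = nothing

module Cone {n d : ℕ} (χ : Colouring n d) where

  cone-outside-rainbow : ∀ {s} → Rainbow χ s → cone χ (outside ∷ᵥ s) ≡ just F.zero
  cone-outside-rainbow {s} r with rainbow? χ s
  ... | yes _ = refl
  ... | no ¬r = contradiction r ¬r

  cone-outside-colour : ∀ {s c} → cone χ (outside ∷ᵥ s) ≡ just c → c ≡ F.zero × Rainbow χ s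
  cone-outside-colour {s} eq with rainbow? χ s | eq
  ... | yes r | refl = refl , r

  cone-uniform : ∀ {k} → d ≡ suc k → Uniform k χ → Uniform (suc k) (cone χ)
  cone-uniform d≡1+k unif (inside  ∷ᵥ s) c eq with χ s in χs≡c′ | eq
  ... | just c′ | refl = cong suc (unif s c′ χs≡c′)
  cone-uniform d≡1+k unif (outside ∷ᵥ s) c eq =
    trans (proj₁ (proj₂ (cone-outside-colour eq))) d≡1+k

  faceColours-inside : ∀ s → faceColours (cone χ) (inside ∷ᵥ s) ≡
    cone χ (outside ∷ᵥ s) ∷ map (M.map F.suc) (faceColours χ s)
  faceColours-inside s = begin
    map (cone χ) (faces (inside ∷ᵥ s))
      ≡⟨ cong (map (cone χ)) (faces-inside s) ⟩
    cone χ (outside ∷ᵥ s) ∷ map (cone χ) (map (inside ∷ᵥ_) (faces s))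
      ≡⟨ cong (cone χ (outside ∷ᵥ s) ∷_) (trans (sym (map-∘ (faces s))) (map-∘ (faces s))) ⟩
    cone χ (outside ∷ᵥ s) ∷ map (M.map F.suc) (faceColours χ s) ∎
    where open ≡-Reasoning

  rainbow-inside : ∀ {s} → Rainbow χ s → Rainbow (cone χ) (inside ∷ᵥ s)
  rainbow-inside {s} r@(size , allJust , unique)
    rewrite faceColours-inside s | cone-outside-rainbow r =
    cong suc size ,
    just _ ∷ Allₚ.map⁺ (All.map is-just-map allJust) ,
    Allₚ.map⁺ (universal (≢-sym ∘ map-suc≢just-zero) (faceColours χ s)) ∷
      Unique-map⁺ (map-injective Finₚ.suc-injective) unique
    where
    is-just-map : ∀ {m : Maybe (Fin d)} → Is-just m → Is-just (M.map F.suc m)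
    is-just-map (just _) = just _

  colourCount-cone-zero : colourCount (cone χ) F.zero ≡ rainbowCount χ
  colourCount-cone-zero = begin
    colourCount (cone χ) F.zero
      ≡⟨ count-allSubsets-suc (λ s → ≡-dec F._≟_ (cone χ s) (just F.zero)) ⟩
    count _ (allSubsets n) + count _ (allSubsets n)
      ≡⟨ cong₂ _+_ (count-none _ (map-suc≢just-zero ∘ χ) (allSubsets n))
                   (count-≐ _ (rainbow? χ) (proj₂ ∘ cone-outside-colour) cone-outside-rainbow
                            (allSubsets n)) ⟩
    rainbowCount χ ∎
    where open ≡-Reasoning

  colourCount-cone-suc : ∀ i → colourCount (cone χ) (F.suc i) ≡ colourCount χ i
  colourCount-cone-suc i = begin
    colourCount (cone χ) (F.suc i)
      ≡⟨ count-allSubsets-suc (λ s → ≡-dec F._≟_ (cone χ s) (just (F.suc i))) ⟩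
    count _ (allSubsets n) + count _ (allSubsets n)
      ≡⟨ cong₂ _+_ (count-≐ _ (λ s → ≡-dec F._≟_ (χ s) (just i))
                            (map-injective Finₚ.suc-injective) (cong (M.map F.suc)) (allSubsets n))
                   (count-none _ (λ s eq → Finₚ.0≢1+n (sym (proj₁ (cone-outside-colour eq))))
                               (allSubsets n)) ⟩
    colourCount χ i + 0
      ≡⟨ +-identityʳ _ ⟩
    colourCount χ i ∎
    where open ≡-Reasoning

  rainbowCount-≤-cone : rainbowCount χ ≤ rainbowCount (cone χ)
  rainbowCount-≤-cone = begin
    rainbowCount χ
      ≤⟨ count-mono (rainbow? χ) _ rainbow-inside (allSubsets n) ⟩
    count (rainbow? (cone χ) ∘ (inside ∷ᵥ_)) (allSubsets n)
      ≤⟨ m≤m+n _ _ ⟩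
    count _ (allSubsets n) + count (rainbow? (cone χ) ∘ (outside ∷ᵥ_)) (allSubsets n)
      ≡⟨ count-allSubsets-suc (rainbow? (cone χ)) ⟨
    rainbowCount (cone χ) ∎
    where open ≤-Reasoning

  colourProduct-cone : colourProduct (cone χ) ≡ rainbowCount χ * colourProduct χ
  colourProduct-cone = cong₂ _*_ colourCount-cone-zero (cong product (begin
    map (colourCount (cone χ)) (tabulate F.suc)          ≡⟨ map-tabulate F.suc _ ⟩
    tabulate (colourCount (cone χ) ∘ F.suc)              ≡⟨ tabulate-cong colourCount-cone-suc ⟩
    tabulate (colourCount χ)                             ≡⟨ map-tabulate (λ i → i) _ ⟨
    map (colourCount χ) (allFin d)                       ∎))
    where open ≡-Reasoning

  colourCount-cone-pos : 0 < rainbowCount χ → (∀ i → 0 < colourCount χ i) →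
                         ∀ i → 0 < colourCount (cone χ) i
  colourCount-cone-pos T>0 C>0 F.zero    = subst (0 <_) (sym colourCount-cone-zero) T>0
  colourCount-cone-pos T>0 C>0 (F.suc i) = subst (0 <_) (sym (colourCount-cone-suc i)) (C>0 i)

ratio-step : ∀ {p q P T T′} k → 0 < T → T ≤ T′ →
             p * P < q * T ^ k → p * (T * P) < q * T′ ^ suc k
ratio-step {p} {q} {P} {T} {T′} k T>0 T≤T′ ratio = begin-strict
  p * (T * P)      ≡⟨ x∙yz≈y∙xz p T P ⟩
  T * (p * P)      <⟨ *-monoʳ-< T {{>-nonZero T>0}} ratio ⟩
  T * (q * T ^ k)  ≡⟨ x∙yz≈y∙xz T q (T ^ k) ⟩
  q * T ^ suc k    ≤⟨ *-monoʳ-≤ q (^-monoˡ-≤ (suc k) T≤T′) ⟩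
  q * T′ ^ suc k   ∎
  where open ≤-Reasoning

proposition3p3 : (d : ℕ) → 3 ≤ d →
    (n : ℕ) (χ : Colouring n d) → Uniform (d ∸ 1) χ → (∀ i → 0 < colourCount χ i) →
    (p q : ℕ) → 0 < q →
    p * colourProduct χ < q * rainbowCount χ ^ (d ∸ 1) →
    Σ ℕ λ m → Σ (Colouring m (suc d)) λ χ′ →
      Uniform d χ′ × (∀ i → 0 < colourCount χ′ i) ×
      p * colourProduct χ′ < q * rainbowCount χ′ ^ d
proposition3p3 (suc (suc k)) (s≤s (s≤s _)) n χ unif C>0 p q _ ratio =
  suc n , cone χ , cone-uniform refl unif , colourCount-cone-pos T>0 C>0 ,
  subst (λ P → p * P < q * rainbowCount (cone χ) ^ suc (suc k)) (sym colourProduct-cone)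
    (ratio-step {p} {q} (suc k) T>0 rainbowCount-≤-cone ratio)
  where
  open Cone χ
  T>0 : 0 < rainbowCount χ
  T>0 = n≢0⇒n>0 λ T≡0 → m<n⇒n≢0 ratio (trans (cong (λ T → q * T ^ suc k) T≡0) (*-zeroʳ q))
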